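{- Let $(Q,*)$ be a finite quasigroup, $G\leq \mathrm{Aut}(Q)$, $e=(e_1,e_2,e_3)\in\mathrm{Ent}(L(Q))$ and $\alpha,\overline{\alpha}\in G$ such that (C1') $\alpha\in \mathrm{Stab}^{\mathrm{row}}_G(e)\setminus \mathrm{Stab}^{\mathrm{col}}_G(e)$; (C2') $\overline{\alpha}\in\mathrm{Stab}^{\mathrm{col}}_G(e)$; (C3') $\overline{\alpha}^{ -1}\alpha\in \mathrm{Stab}^{\mathrm{sym}}_G(e)$; and suppose moreover that (B1) $\mathrm{Stab}^{\mathrm{row}}_G(e)=\langle\alpha\rangle$; (B2) $\mathrm{Stab}^{\mathrm{col}}_G(e)=\langle\overline{\alpha}\rangle$; (B3) $\mathrm{Stab}^{\mathrm{sym}}_G(e)=\langle\overline{\alpha}^{ -1}\alpha\rangle$; (B4) $|\langle\alpha\rangle\cap\langle\overline{\alpha}\rangle|=1$. Let $a=\alpha^{ -1}$, $b=\overline{\alpha}$, $c=\overline{\alpha}^{ -1}\alpha$, $A=\langle a\rangle$, $B=\langle b\rangle$, $C=\langle c\rangle$. Let $T=\{g(e)\mid g\in G\}$ and $T'=\{g((e_1,e_2,\alpha(e_3)))\mid g\in G\}$, and let $T^\circ=\{(gA,gB,gC)\mid g\in G\}$ and $T^*=\{(gA,gB,ga^{ -1}C)\mid g\in G\}$ (triples of left cosets in $G$). Then $(T,T')$ is isotopic to $(T^\circ,T^*)$ via the pair of maps $(\Theta,\Theta')$ given by $$\Theta(g(e))=(gA,gB,gC),\qquad \Theta'(g((e_1,e_2,\alpha(e_3))))=(gA,gB,ga^{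 -1}C)\qquad (g\in G).$$
   Context: A quasigroup $(Q,*)$ is a finite set $Q$ with a binary operation such that for all $i,j\in Q$ the equations $i*x=j$ and $y*i=j$ have unique solutions; write $ij$ for $i*j$. Its Cayley table $L(Q)$ is identified with $\mathrm{Ent}(L(Q))=\{(i,j,ij)\mid i,j\in Q\}$ (row, column, symbol). $\mathrm{Aut}(Q)$ is the group of permutations $f$ of $Q$ with $f(ij)=f(i)f(j)$ for all $i,j$; an automorphism $g$ acts on triples coordinatewise, $g((x_1,x_2,x_3))=(g(x_1),g(x_2),g(x_3))$. For $G\leq\mathrm{Aut}(Q)$ and $e=(e_1,e_2,e_3)$: $\mathrm{Stab}^{\mathrm{row}}_G(e)=\{g\in G\mid g(e_1)=e_1\}$, $\mathrm{Stab}^{\mathrm{col}}_G(e)=\{g\in G\mid g(e_2)=e_2\}$, $\mathrm{Stab}^{\mathrm{sym}}_G(e)=\{g\in G\mid g(e_3)=e_3\}$, and $\mathrm{Stab}_G(e)$ is their intersection. (In this setting $(T,T')$ is a Latin bitrade in $L(Q)$.) A set of triples $X$ is isotopic to a set of triples $Y$ via a map $\Phi:X\to Y$ if $\Phi$ is a well-defined bijection from $X$ onto $Y$ that preserves rows, columns and symbols, i.e. there are bijections $\varphi_1,\varphi_2,\varphi_3$ between the respective row, column and symbol label sets with $\Phi((x_1,x_2,x_3))=(\varphi_1(x_1),\varphi_2(x_2),\varphi_3(x_3))$; a pair $(T,T')$ is isotopic to $(T^\circ,T^*)$ via $(\Theta,\Theta')$ if $T$ is isotopic to $T^\circ$ via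 $\Theta$ and $T'$ is isotopic to $T^*$ via $\Theta'$. -}

module Defs where

open import Level using (Level)
open import Data.Nat using (ℕ; zero; suc)
open import Data.Fin using (Fin)
open import Data.Integer using (ℤ; +_; -[1+_])
open import Data.Product using (Σ; ∃; ∃!; _×_; _,_; proj₁; proj₂)
open import Relation.Binary.PropositionalEquality using (_≡_)
open import Function.Bundles using (_⇔_)
import Data.Fin.Permutation as P
open P using (Permutation′; _⟨$⟩ʳ_) public

Perm : ℕ → Set
Perm n = Permutation′ n

-- functional composition: (g ⊚ h) x = g (h x)   (stdlib ∘ₚ is diagrammatic)
infixr 9 _⊚_
_⊚_ : ∀ {n} → Perm n → Perm n → Perm n
g ⊚ h = h P.∘ₚ g

infix 10 _⁻¹
_⁻¹ : ∀ {n} → Perm n → Perm n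
g ⁻¹ = P.flip g

idP : ∀ {n} → Perm n
idP = P.id

infix 4 _≈ₚ_
_≈ₚ_ : ∀ {n} → Perm n → Perm n → Set
_≈ₚ_ = P._≈_

powℕ : ∀ {n} → Perm n → ℕ → Perm n
powℕ g zero    = idP
powℕ g (suc k) = g ⊚ powℕ g k

pow : ∀ {n} → Perm n → ℤ → Perm n
pow g (+ k)    = powℕ g k
pow g -[1+ k ] = powℕ (g ⁻¹) (suc k)

PSet : ℕ → Set₁
PSet n = Perm n → Set

infix 4 _≐_
_≐_ : ∀ {n} → PSet n → PSet n → Set
X ≐ Y = ∀ σ → X σ ⇔ Y σ

⟨_⟩ : ∀ {n} → Perm n → PSet n
⟨ x ⟩ σ = ∃ λ (k : ℤ) → σ ≈ₚ pow x k

infix 8 _·_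
_·_ : ∀ {n} → Perm n → PSet n → PSet n
(g · H) σ = ∃ λ h → H h × σ ≈ₚ g ⊚ h

Op : ℕ → Set
Op n = Fin n → Fin n → Fin n

record IsQuasigroup {n : ℕ} (_∙_ : Op n) : Set where
  field
    leftSol  : ∀ i j → ∃! _≡_ (λ x → i ∙ x ≡ j)
    rightSol : ∀ i j → ∃! _≡_ (λ y → y ∙ i ≡ j)

IsAut : ∀ {n} → Op n → Perm n → Set
IsAut _∙_ f = ∀ i j → f ⟨$⟩ʳ (i ∙ j) ≡ (f ⟨$⟩ʳ i) ∙ (f ⟨$⟩ʳ j)

record IsSubgroupOfAut {n : ℕ} (_∙_ : Op n) (G : PSet n) : Set where
  field
    ⊆Aut    : ∀ g → G g → IsAut _∙_ g
    resp-≈  : ∀ g h → g ≈ₚ h → G g → G h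
    id-mem  : G idP
    ∘-mem   : ∀ g h → G g → G h → G (g ⊚ h)
    inv-mem : ∀ g → G g → G (g ⁻¹)

Triple : ℕ → Set
Triple n = Fin n × Fin n × Fin n

row col sym : ∀ {n} → Triple n → Fin n
row (x , _ , _) = x
col (_ , y , _) = y
sym (_ , _ , z) = z

actT : ∀ {n} → Perm n → Triple n → Triple n
actT g (x , y , z) = (g ⟨$⟩ʳ x , g ⟨$⟩ʳ y , g ⟨$⟩ʳ z)

InEnt : ∀ {n} → Op n → Triple n → Set
InEnt _∙_ (x , y , z) = z ≡ x ∙ y

Stab-row Stab-col Stab-sym : ∀ {n} → PSet n → Triple n → PSet n
Stab-row G e g = G g × g ⟨$⟩ʳ row e ≡ row e
Stab-col G e g = G g × g ⟨$⟩ʳ col e ≡ col e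
Stab-sym G e g = G g × g ⟨$⟩ʳ sym e ≡ sym e

Orbit : ∀ {n} → PSet n → Triple n → Triple n → Set
Orbit {n} G t x = Σ (Perm n) λ g → G g × x ≡ actT g t

CTriple : ℕ → Set₁
CTriple n = PSet n × PSet n × PSet n

crow ccol csym : ∀ {n} → CTriple n → PSet n
crow (X , _ , _) = X
ccol (_ , Y , _) = Y
csym (_ , _ , Z) = Z

infix 4 _≐³_
_≐³_ : ∀ {n} → CTriple n → CTriple n → Set
(X , Y , Z) ≐³ (X' , Y' , Z') = (X ≐ X') × (Y ≐ Y') × (Z ≐ Z')

CosetOrbit : ∀ {n} → PSet n → (Perm n → CTriple n) → CTriple n → Set
CosetOrbit G f Y = ∃ λ g → G g × Y ≐³ f g

induced : ∀ {n} {G : PSet n} {t x : Triple n} → (Perm n → CTriple n) → Orbit G t x → CTriple n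
induced f (g , _ , _) = f g

-- φ is a bijection from the label set {π x | x ∈ X} onto {ρ y | y ∈ Y}
record LabelBij {n : ℕ} (MemX : Triple n → Set) (MemY : CTriple n → Set)
                (π : Triple n → Fin n) (ρ : CTriple n → PSet n)
                (φ : Fin n → PSet n) : Set₁ where
  LabX : Fin n → Set
  LabX r = ∃ λ x → MemX x × π x ≡ r
  LabY : PSet n → Set₁
  LabY R = Σ (CTriple n) λ y → MemY y × ρ y ≐ R
  field
    into : ∀ r → LabX r → LabY (φ r)
    inj  : ∀ r r' → LabX r → LabX r' → φ r ≐ φ r' → r ≡ r'
    onto : ∀ R → LabY R → ∃ λ r → LabX r × φ r ≐ R

record IsotopicVia {n : ℕ} (MemX : Triple n → Set) (MemY : CTriple n → Set)
                   (Φ : ∀ {x} → MemX x → CTriple n) : Set₁ where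
  field
    well-defined : ∀ {x} (p q : MemX x) → Φ p ≐³ Φ q
    into         : ∀ {x} (p : MemX x) → MemY (Φ p)
    injective    : ∀ {x y} (p : MemX x) (q : MemX y) → Φ p ≐³ Φ q → x ≡ y
    surjective   : ∀ y → MemY y → Σ (Triple n) λ x → Σ (MemX x) λ p → Φ p ≐³ y
    φ₁ φ₂ φ₃     : Fin n → PSet n
    bij₁         : LabelBij MemX MemY row crow φ₁
    bij₂         : LabelBij MemX MemY col ccol φ₂
    bij₃         : LabelBij MemX MemY sym csym φ₃
    coordinatewise : ∀ {x} (p : MemX x) → Φ p ≐³ (φ₁ (row x) , φ₂ (col x) , φ₃ (sym x))

{-# OPTIONS --safe #-}

-- Every entry of T or T′ is g(t) for a triple t of points of Q and some g ∈ G,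
-- and each coordinate of Θ resp. Θ′ is a left coset of the stabiliser (in G)
-- of the corresponding point, possibly translated on the right by a fixed
-- element of G: B1–B3 say exactly that A, B, C are these stabilisers, and a⁻¹
-- moves e₃ to α(e₃). By orbit–stabiliser, gH = hH iff g and h agree on the
-- point stabilised by H, so each coordinate of g(t) determines the
-- corresponding coset and conversely; this gives the three label bijections,
-- and together they make Θ and Θ′ well defined, injective and coordinatewise.
module Submission where

open import Defs
open import Data.Nat using (ℕ; zero; suc)
open import Data.Fin using (Fin)
open import Data.Integer using (ℤ; -_; +_; -[1+_])
open import Data.Product using (Σ; _×_; _,_; proj₁; proj₂)
open import Relation.Nullary using (¬_)
open import Relation.Binary.PropositionalEquality
  using (_≡_; refl; trans; cong; cong₂) renaming (sym to ≡-sym)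
open import Function.Bundles using (_⇔_; mk⇔; Equivalence)
import Data.Fin.Permutation as P
open P using (_⟨$⟩ˡ_)

open Equivalence using (to; from)

module _ {n : ℕ} where

  ≐-refl : {X : PSet n} → X ≐ X
  ≐-refl σ = mk⇔ (λ x → x) (λ x → x)

  ≐-sym : {X Y : PSet n} → X ≐ Y → Y ≐ X
  ≐-sym p σ = mk⇔ (from (p σ)) (to (p σ))

  ≐-trans : {X Y Z : PSet n} → X ≐ Y → Y ≐ Z → X ≐ Z
  ≐-trans p q σ = mk⇔ (λ x → to (q σ) (to (p σ) x)) (λ x → from (p σ) (from (q σ) x))

  ≐³-refl : {X : CTriple n} → X ≐³ X
  ≐³-refl = ≐-refl , ≐-refl , ≐-refl

  ≐³-sym : {X Y : CTriple n} → X ≐³ Y → Y ≐³ X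
  ≐³-sym (p , q , r) = ≐-sym p , ≐-sym q , ≐-sym r

  powℕ-cong : {g h : Perm n} → g ≈ₚ h → ∀ k → powℕ g k ≈ₚ powℕ h k
  powℕ-cong g≈h zero    i = refl
  powℕ-cong {g} g≈h (suc k) i = trans (cong (g ⟨$⟩ʳ_) (powℕ-cong g≈h k i)) (g≈h _)

  pow-⁻¹ : (g : Perm n) (k : ℤ) → pow (g ⁻¹) k ≈ₚ pow g (- k)
  pow-⁻¹ g (+ zero)  i = refl
  pow-⁻¹ g (+ suc k) i = refl
  pow-⁻¹ g -[1+ k ]    = powℕ-cong {(g ⁻¹) ⁻¹} {g} (λ i → refl) (suc k)

  pow-neg : (g : Perm n) (k : ℤ) → pow g k ≈ₚ pow (g ⁻¹) (- k)
  pow-neg g (+ zero)  i = refl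
  pow-neg g (+ suc k)   = powℕ-cong {g} {(g ⁻¹) ⁻¹} (λ i → refl) (suc k)
  pow-neg g -[1+ k ]  i = refl

  ⟨⁻¹⟩≐⟨⟩ : (g : Perm n) → ⟨ g ⁻¹ ⟩ ≐ ⟨ g ⟩
  ⟨⁻¹⟩≐⟨⟩ g σ = mk⇔
    (λ { (k , σ≈) → - k , λ i → trans (σ≈ i) (pow-⁻¹ g k i) })
    (λ { (k , σ≈) → - k , λ i → trans (σ≈ i) (pow-neg g k i) })

  Stab : PSet n → Fin n → PSet n
  Stab G q g = G g × g ⟨$⟩ʳ q ≡ q

  LabelsOrbit : PSet n → Fin n → (Perm n → PSet n) → Set
  LabelsOrbit G t K = ∀ {g h} → G g → G h → (K g ≐ K h) ⇔ (g ⟨$⟩ʳ t ≡ h ⟨$⟩ʳ t)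

module _ {n : ℕ} {_∙_ : Op n} {G : PSet n} (SG : IsSubgroupOfAut _∙_ G) where
  open IsSubgroupOfAut SG

  private
    coset-shift : ∀ {q H g h} → H ≐ Stab G q → G g → G h →
                  g ⟨$⟩ʳ q ≡ h ⟨$⟩ʳ q → ∀ σ → (g · H) σ → (h · H) σ
    coset-shift {q} {H} {g} {h} H≐ Gg Gh gq≡hq σ (x , Hx , σ≈gx) =
      u , from (H≐ u) (Gu , uq≡q) , λ i → trans (σ≈gx i) (≡-sym (P.inverseʳ h))
      where
        u : Perm n
        u = h ⁻¹ ⊚ g ⊚ x
        Gx : G x
        Gx = proj₁ (to (H≐ x) Hx)
        Gu : G u
        Gu = ∘-mem _ _ (inv-mem h Gh) (∘-mem g x Gg Gx)
        uq≡q : u ⟨$⟩ʳ q ≡ q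
        uq≡q = trans (cong (λ y → h ⟨$⟩ˡ (g ⟨$⟩ʳ y)) (proj₂ (to (H≐ x) Hx)))
                     (trans (cong (h ⟨$⟩ˡ_) gq≡hq) (P.inverseˡ h))

  cosets-of-stabiliser : ∀ {q H} → H ≐ Stab G q → LabelsOrbit G q (_· H)
  cosets-of-stabiliser {q} {H} H≐ {g} {h} Gg Gh = mk⇔ agree shift
    where
      shift : g ⟨$⟩ʳ q ≡ h ⟨$⟩ʳ q → g · H ≐ h · H
      shift gq≡hq σ = mk⇔ (coset-shift H≐ Gg Gh gq≡hq σ) (coset-shift H≐ Gh Gg (≡-sym gq≡hq) σ)
      agree : g · H ≐ h · H → g ⟨$⟩ʳ q ≡ h ⟨$⟩ʳ q
      agree gH≐hH with to (gH≐hH g) (idP , from (H≐ idP) (id-mem , refl) , λ i → refl)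
      ... | x , Hx , g≈hx = trans (g≈hx q) (cong (h ⟨$⟩ʳ_) (proj₂ (to (H≐ x) Hx)))

  LabelsOrbit-translate : ∀ {q K k} → G k → LabelsOrbit G q K →
                          LabelsOrbit G (k ⟨$⟩ʳ q) (λ g → K (g ⊚ k))
  LabelsOrbit-translate Gk ℓ Gg Gh = ℓ (∘-mem _ _ Gg Gk) (∘-mem _ _ Gh Gk)

module _ {n : ℕ} (G : PSet n) where

  -- The label map φᵢ: a point r of the orbit of t goes to the common set K g of all g ∈ G with g(t) = r.
  cosetAt : Fin n → (Perm n → PSet n) → Fin n → PSet n
  cosetAt t K r σ = Σ (Perm n) λ g → G g × g ⟨$⟩ʳ t ≡ r × K g σ

  cosetAt-orbit : ∀ {t K g} → LabelsOrbit G t K → G g → cosetAt t K (g ⟨$⟩ʳ t) ≐ K g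
  cosetAt-orbit ℓ Gg σ = mk⇔
    (λ { (h , Gh , ht≡gt , Khσ) → to (from (ℓ Gh Gg) ht≡gt σ) Khσ })
    (λ Kgσ → _ , Gg , refl , Kgσ)

module Isotopy {n : ℕ} (G : PSet n) {t₁ t₂ t₃ : Fin n} {K₁ K₂ K₃ : Perm n → PSet n}
  (ℓ₁ : LabelsOrbit G t₁ K₁) (ℓ₂ : LabelsOrbit G t₂ K₂) (ℓ₃ : LabelsOrbit G t₃ K₃) where

  t : Triple n
  t = (t₁ , t₂ , t₃)

  Θ : Perm n → CTriple n
  Θ g = (K₁ g , K₂ g , K₃ g)

  module Coordinate (π : Triple n → Fin n) (ρ : CTriple n → PSet n) {tᵢ : Fin n} {K : Perm n → PSet n}
    (π-act : ∀ g → π (actT g t) ≡ g ⟨$⟩ʳ tᵢ) (ρ-Θ : ∀ g → ρ (Θ g) ≡ K g)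
    (ρ-cong : ∀ {y y'} → y ≐³ y' → ρ y ≐ ρ y') (ℓ : LabelsOrbit G tᵢ K) where

    atLabel : ∀ {g r} → G g → π (actT g t) ≡ r → cosetAt G tᵢ K r ≐ K g
    atLabel {g} Gg refl rewrite π-act g = cosetAt-orbit G ℓ Gg

    ρ-Θ≐ : ∀ g → ρ (Θ g) ≐ K g
    ρ-Θ≐ g rewrite ρ-Θ g = ≐-refl

    labelBij : LabelBij (Orbit G t) (CosetOrbit G Θ) π ρ (cosetAt G tᵢ K)
    labelBij .LabelBij.into r (_ , (g , Gg , refl) , πx≡r) =
      Θ g , (g , Gg , ≐³-refl) , ≐-trans (ρ-Θ≐ g) (≐-sym (atLabel Gg πx≡r))
    labelBij .LabelBij.inj r r' (_ , (g , Gg , refl) , πx≡r) (_ , (h , Gh , refl) , πy≡r') φr≐φr' =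
      trans (≡-sym πx≡r) (trans (π-act g) (trans (to (ℓ Gg Gh) Kg≐Kh) (trans (≡-sym (π-act h)) πy≡r')))
      where
        Kg≐Kh : K g ≐ K h
        Kg≐Kh = ≐-trans (≐-sym (atLabel Gg πx≡r)) (≐-trans φr≐φr' (atLabel Gh πy≡r'))
    labelBij .LabelBij.onto R (y , (g , Gg , y≐Θg) , ρy≐R) =
      π (actT g t) , (actT g t , (g , Gg , refl) , refl) ,
      ≐-trans (atLabel Gg refl) (≐-trans (≐-sym (ρ-Θ≐ g)) (≐-trans (ρ-cong (≐³-sym y≐Θg)) ρy≐R))

  open Coordinate using (labelBij)

  isotopic : IsotopicVia (Orbit G t) (CosetOrbit G Θ) (induced Θ)
  isotopic = record
    { well-defined = well-defined
    ; into = λ { (g , Gg , _) → g , Gg , ≐³-refl }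
    ; injective = injective
    ; surjective = λ { _ (g , Gg , y≐Θg) → actT g t , (g , Gg , refl) , ≐³-sym y≐Θg }
    ; φ₁ = cosetAt G t₁ K₁ ; φ₂ = cosetAt G t₂ K₂ ; φ₃ = cosetAt G t₃ K₃
    ; bij₁ = labelBij row crow (λ _ → refl) (λ _ → refl) proj₁ ℓ₁
    ; bij₂ = labelBij col ccol (λ _ → refl) (λ _ → refl) (λ p → proj₁ (proj₂ p)) ℓ₂
    ; bij₃ = labelBij sym csym (λ _ → refl) (λ _ → refl) (λ p → proj₂ (proj₂ p)) ℓ₃
    ; coordinatewise = λ { (g , Gg , refl) →
        ≐-sym (cosetAt-orbit G ℓ₁ Gg) , ≐-sym (cosetAt-orbit G ℓ₂ Gg) , ≐-sym (cosetAt-orbit G ℓ₃ Gg) }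
    }
    where
      well-defined : ∀ {x} (p q : Orbit G t x) → induced Θ p ≐³ induced Θ q
      well-defined (g , Gg , x≡gt) (h , Gh , x≡ht) =
        from (ℓ₁ Gg Gh) (cong row gt≡ht) , from (ℓ₂ Gg Gh) (cong col gt≡ht) , from (ℓ₃ Gg Gh) (cong sym gt≡ht)
        where
          gt≡ht : actT g t ≡ actT h t
          gt≡ht = trans (≡-sym x≡gt) x≡ht

      injective : ∀ {x y} (p : Orbit G t x) (q : Orbit G t y) → induced Θ p ≐³ induced Θ q → x ≡ y
      injective (g , Gg , refl) (h , Gh , refl) (K₁≐ , K₂≐ , K₃≐) =
        cong₂ _,_ (to (ℓ₁ Gg Gh) K₁≐) (cong₂ _,_ (to (ℓ₂ Gg Gh) K₂≐) (to (ℓ₃ Gg Gh) K₃≐))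

theorem3 : ∀ {n : ℕ} (_∙_ : Op n) → IsQuasigroup _∙_
  → (G : PSet n) → IsSubgroupOfAut _∙_ G
  → (e₁ e₂ e₃ : Fin n) → InEnt _∙_ (e₁ , e₂ , e₃)
  → (α ᾱ : Perm n)
  → Stab-row G (e₁ , e₂ , e₃) α → ¬ Stab-col G (e₁ , e₂ , e₃) α
  → Stab-col G (e₁ , e₂ , e₃) ᾱ
  → Stab-sym G (e₁ , e₂ , e₃) (ᾱ ⁻¹ ⊚ α)
  → Stab-row G (e₁ , e₂ , e₃) ≐ ⟨ α ⟩
  → Stab-col G (e₁ , e₂ , e₃) ≐ ⟨ ᾱ ⟩
  → Stab-sym G (e₁ , e₂ , e₃) ≐ ⟨ ᾱ ⁻¹ ⊚ α ⟩
  → (∀ σ → ⟨ α ⟩ σ → ⟨ ᾱ ⟩ σ → σ ≈ₚ idP)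
  → let a = α ⁻¹
        b = ᾱ
        c = ᾱ ⁻¹ ⊚ α
        A = ⟨ a ⟩
        B = ⟨ b ⟩
        C = ⟨ c ⟩
        Θf : Perm n → CTriple n
        Θf g = (g · A , g · B , g · C)
        Θ'f : Perm n → CTriple n
        Θ'f g = (g · A , g · B , (g ⊚ a ⁻¹) · C)
    in IsotopicVia (Orbit G (e₁ , e₂ , e₃)) (CosetOrbit G Θf) (induced Θf)
       × IsotopicVia (Orbit G (e₁ , e₂ , α ⟨$⟩ʳ e₃)) (CosetOrbit G Θ'f) (induced Θ'f)
theorem3 _ _ G SG e₁ e₂ e₃ _ α ᾱ (Gα , _) _ _ _ B1 B2 B3 _ =
  Isotopy.isotopic G ℓA ℓB ℓC , Isotopy.isotopic G ℓA ℓB ℓa⁻¹C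
  where
    open IsSubgroupOfAut SG using (inv-mem)
    ℓA : LabelsOrbit G e₁ (_· ⟨ α ⁻¹ ⟩)
    ℓA = cosets-of-stabiliser SG (≐-trans (⟨⁻¹⟩≐⟨⟩ α) (≐-sym B1))
    ℓB : LabelsOrbit G e₂ (_· ⟨ ᾱ ⟩)
    ℓB = cosets-of-stabiliser SG (≐-sym B2)
    ℓC : LabelsOrbit G e₃ (_· ⟨ ᾱ ⁻¹ ⊚ α ⟩)
    ℓC = cosets-of-stabiliser SG (≐-sym B3)
    ℓa⁻¹C : LabelsOrbit G (α ⟨$⟩ʳ e₃) (λ g → (g ⊚ (α ⁻¹) ⁻¹) · ⟨ ᾱ ⁻¹ ⊚ α ⟩)
    ℓa⁻¹C = LabelsOrbit-translate SG (inv-mem _ (inv-mem α Gα)) ℓC
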